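{- If $n=|N|\ge 3$ then, for every $a\in N$, the inequality $\sum_{B:\,\emptyset\neq B\subseteq N\setminus\{a\}}\eta(a|B)\le 1$ defines a facet of $\mathbb{F}$.
   Context: Let $N$ be a finite set with $n=|N|\ge 2$, and let $\mathrm{DAG}(N)$ be the set of acyclic directed graphs with node set $N$; $\mathrm{pa}_G(a)$ denotes the set of parents of $a$ in $G$. Let $\Upsilon=\{(a|B): a\in N,\ \emptyset\neq B\subseteq N\setminus\{a\}\}$. For $G\in\mathrm{DAG}(N)$, $\eta_G\in\mathbb{R}^{\Upsilon}$ is given by $\eta_G(a|B)=1$ if $B=\mathrm{pa}_G(a)$ and $0$ otherwise. The family-variable polytope is $\mathbb{F}=\mathrm{conv}\{\eta_G: G\in\mathrm{DAG}(N)\}$, of dimension $|\Upsilon|$. A facet is a face of dimension $\dim\mathbb{F}-1$. -}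

module Defs where

open import Data.Nat using (ℕ; zero; suc)
open import Data.Fin using (Fin)
open import Data.Fin.Subset using (Subset; _∈_; _∉_; Nonempty; inside; outside)
open import Data.Fin.Subset.Properties using (_∈?_; nonempty?)
open import Data.Bool using (Bool; true; false)
import Data.Bool as Bool
open import Data.Vec using (Vec; []; _∷_)
open import Data.Vec.Properties using (≡-dec)
open import Data.List using (List; []; _∷_; _++_; map)
open import Data.Rational using (ℚ; 0ℚ; 1ℚ; _+_; _*_; _≤_)
open import Data.Product using (Σ; _×_; ∃; _,_)
open import Relation.Nullary using (¬_; Dec; yes; no)
open import Relation.Binary.PropositionalEquality using (_≡_)

-- Node set N = Fin n.  A directed graph on N is given by its parent
-- function: i → a is an arrow iff i ∈ pa a.

data Walk {n : ℕ} (pa : Fin n → Subset n) : Fin n → Fin n → Set where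
  edge : ∀ {i j} → i ∈ pa j → Walk pa i j
  step : ∀ {i j k} → i ∈ pa j → Walk pa j k → Walk pa i k

Acyclic : {n : ℕ} → (Fin n → Subset n) → Set
Acyclic {n} pa = (i : Fin n) → ¬ Walk pa i i

DAG : ℕ → Set
DAG n = Σ (Fin n → Subset n) Acyclic

paOf : {n : ℕ} → DAG n → Fin n → Subset n
paOf (pa , _) = pa

InΥ : {n : ℕ} → Fin n → Subset n → Set
InΥ a B = (a ∉ B) × Nonempty B

-- points of ℝ^Υ are represented (over ℚ) as functions on all pairs (a,B);
-- only coordinates with InΥ a B are ever inspected.
Point : ℕ → Set
Point n = Fin n → Subset n → ℚ

_≟ₛ_ : {n : ℕ} → (A B : Subset n) → Dec (A ≡ B)
_≟ₛ_ = ≡-dec Bool._≟_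

η : {n : ℕ} → DAG n → Point n
η G a B with B ≟ₛ paOf G a
... | yes _ = 1ℚ
... | no  _ = 0ℚ

allSubsets : (n : ℕ) → List (Subset n)
allSubsets zero    = [] ∷ []
allSubsets (suc n) = map (outside ∷_) (allSubsets n) ++ map (inside ∷_) (allSubsets n)

sumFamily : {n : ℕ} → Fin n → Point n → ℚ
sumFamily {n} a x = go (allSubsets n)
  where
  go : List (Subset n) → ℚ
  go [] = 0ℚ
  go (B ∷ Bs) with a ∈? B | nonempty? B
  ... | no _ | yes _ = x a B + go Bs
  ... | _    | _     = go Bs

sumℚ : (k : ℕ) → (Fin k → ℚ) → ℚ
sumℚ zero    f = 0ℚ
sumℚ (suc k) f = f Fin.zero + sumℚ k (λ i → f (Fin.suc i))

AffinelyIndependent : {n k : ℕ} → (Fin k → Point n) → Set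
AffinelyIndependent {n} {k} p =
  (λ′ : Fin k → ℚ) →
  sumℚ k λ′ ≡ 0ℚ →
  ((a : Fin n) (B : Subset n) → InΥ a B → sumℚ k (λ i → λ′ i * p i a B) ≡ 0ℚ) →
  (i : Fin k) → λ′ i ≡ 0ℚ

-- affine dimension of the polytope conv{η_G : G ∈ DAG(N), V G}
-- (the convex hull of a set of points has the affine dimension of the set):
-- it is d iff there are d+1 affinely independent such points but no d+2.
ConvDim : {n : ℕ} → (DAG n → Set) → ℕ → Set
ConvDim {n} V d =
  (Σ (Fin (suc d) → DAG n) λ Gs →
     ((i : Fin (suc d)) → V (Gs i)) × AffinelyIndependent (λ i → η (Gs i)))
  × ((Gs : Fin (suc (suc d)) → DAG n) →
     ((i : Fin (suc (suc d))) → V (Gs i)) → ¬ AffinelyIndependent (λ i → η (Gs i)))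

AllDAGs : {n : ℕ} → DAG n → Set
AllDAGs _ = Data.Unit.⊤
  where import Data.Unit

-- the linear inequality  c(x) ≤ β  defines a facet of 𝔽 = conv{η_G}:
-- it is valid on 𝔽 (equivalently on all vertices η_G), and the face
-- {x ∈ 𝔽 : c(x) = β} = conv{η_G : c(η_G) = β} has dimension dim 𝔽 − 1.
DefinesFacet : {n : ℕ} → (Point n → ℚ) → ℚ → Set
DefinesFacet {n} c β =
  ((G : DAG n) → c (η G) ≤ β)
  × ∃ λ d → ConvDim (λ G → c (η G) ≡ β) d × ConvDim {n} AllDAGs (suc d)

-- A DAG has exactly one parent set of a, so the family variables of a sum to 0 or 1. Let m = |Υ|.
-- Gaussian elimination shows that ℚ^Υ contains no m + 2 affinely independent points, and η of the
-- empty graph is affinely independent of any points on the face, so it suffices to find m affinely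
-- independent vertices on the face: then dim 𝔽 = m and the face has dimension m − 1. The vertex for
-- (b|C) ∈ Υ gives b the parents C and, when b ≢ a, gives a a single parent x ∉ {a, b} (this is
-- where n ≥ 3 is used); ranking the families of a last, these vertices form a unitriangular matrix.

module Submission where

open import Defs
open import Data.Nat using (ℕ; zero; suc; _≤_; _<_; _≥_; z≤n; s≤s; s≤s⁻¹)
open import Data.Nat.Properties using (≤-refl; ≤-reflexive; <-≤-trans; ≮⇒≥; _<?_; <-trans; <-irrefl)
open import Data.Fin using (Fin; zero; suc; _≟_)
open import Data.Fin.Properties using (suc-injective)
open import Data.Fin.Patterns using (0F; 1F; 2F)
open import Data.Fin.Subset using (Subset; _∈_; _∉_; Nonempty; inside; outside; ⁅_⁆) renaming (⊥ to ∅)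
open import Data.Fin.Subset.Properties using (_∈?_; nonempty?; ∉⊥; x∈⁅x⁆; x∈⁅y⁆⇒x≡y)
open import Data.Vec using ([]; _∷_)
open import Data.Vec.Properties using (∷-injectiveʳ)
open import Data.Vec.Functional as Vector using (Vector)
open import Data.List using (List; []; _∷_; _++_; map; length; lookup; filter; cartesianProduct; allFin)
open import Data.List.Properties using (length-map)
open import Data.List.Relation.Unary.Any using (Any; here; there)
open import Data.List.Relation.Unary.All as All using (All; []; _∷_; all?)
open import Data.List.Relation.Unary.All.Properties using (map⁻; all-filter; ¬All⇒Any¬)
open import Data.List.Relation.Unary.AllPairs using ([]; _∷_)
open import Data.List.Relation.Unary.Unique.Propositional using (Unique)
import Data.List.Relation.Unary.Unique.Propositional.Properties as Unique
open import Data.List.Membership.Propositional using (find) renaming (_∈_ to _∈ₗ_)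
open import Data.List.Membership.Propositional.Properties
  using (∈-map⁺; ∈-map⁻; ∈-++⁺ˡ; ∈-++⁺ʳ; ∈-lookup; ∈-filter⁺; ∈-cartesianProduct⁺; ∈-allFin; ∈-∃++)
open import Data.List.Relation.Binary.Permutation.Propositional using (_↭_; ↭-sym)
open import Data.List.Relation.Binary.Permutation.Propositional.Properties using (All-resp-↭; ↭-length; shift)
open import Data.Rational using (ℚ; 0ℚ; 1ℚ; _+_; _*_; -_; 1/_)
import Data.Rational as ℚ
open import Data.Rational.Properties
  using (1≢0; +-identityˡ; +-identityʳ; *-identityˡ; *-identityʳ; *-zeroˡ; *-zeroʳ; *-assoc; *-distribˡ-+; *-inverseˡ; nonNegative⁻¹; +-0-commutativeMonoid)
  renaming (_≟_ to _≟ℚ_; ≤-refl to ≤ℚ-refl)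
open import Data.Rational.Solver using (module +-*-Solver)
open import Algebra.Bundles using (CommutativeMonoid)
open import Algebra.Properties.CommutativeSemigroup
  (CommutativeMonoid.commutativeSemigroup +-0-commutativeMonoid) using (interchange)
open import Data.Product using (Σ; ∃; ∃₂; _×_; _,_; proj₁; proj₂; uncurry)
open import Data.Sum using (_⊎_; inj₁; inj₂; [_,_]′)
open import Data.Empty using (⊥; ⊥-elim)
open import Function using (_∘_)
open import Relation.Nullary using (¬_; Dec; yes; no; contradiction)
open import Relation.Nullary.Decidable using (_×-dec_; ¬?)
open import Relation.Binary.PropositionalEquality
  using (_≡_; _≢_; refl; sym; trans; cong; cong₂; subst; ≢-sym; module ≡-Reasoning)

sumℚ-cong : ∀ k {f g : Fin k → ℚ} → (∀ i → f i ≡ g i) → sumℚ k f ≡ sumℚ k g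
sumℚ-cong zero    f≗g = refl
sumℚ-cong (suc k) f≗g = cong₂ _+_ (f≗g zero) (sumℚ-cong k (f≗g ∘ suc))

sumℚ-zero : ∀ k {f : Fin k → ℚ} → (∀ i → f i ≡ 0ℚ) → sumℚ k f ≡ 0ℚ
sumℚ-zero zero    f≗0 = refl
sumℚ-zero (suc k) f≗0 = cong₂ _+_ (f≗0 zero) (sumℚ-zero k (f≗0 ∘ suc))

sumℚ-+ : ∀ k (f g : Fin k → ℚ) → sumℚ k (λ i → f i + g i) ≡ sumℚ k f + sumℚ k g
sumℚ-+ zero    f g = refl
sumℚ-+ (suc k) f g = trans (cong (f zero + g zero +_) (sumℚ-+ k (f ∘ suc) (g ∘ suc)))
                           (interchange (f zero) (g zero) _ _)

sumℚ-*ˡ : ∀ k c (f : Fin k → ℚ) → sumℚ k (λ i → c * f i) ≡ c * sumℚ k f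
sumℚ-*ˡ zero    c f = sym (*-zeroʳ c)
sumℚ-*ˡ (suc k) c f = trans (cong (c * f zero +_) (sumℚ-*ˡ k c (f ∘ suc))) (sym (*-distribˡ-+ c _ _))

sumℚ-single : ∀ k {f : Fin k → ℚ} j → (∀ i → i ≢ j → f i ≡ 0ℚ) → sumℚ k f ≡ f j
sumℚ-single (suc k) {f} zero    f≡0 =
  trans (cong (f zero +_) (sumℚ-zero k (λ i → f≡0 (suc i) λ ()))) (+-identityʳ _)
sumℚ-single (suc k) {f} (suc j) f≡0 =
  trans (cong₂ _+_ (f≡0 zero λ ()) (sumℚ-single k j (λ i i≢j → f≡0 (suc i) (i≢j ∘ suc-injective))))
        (+-identityˡ _)

p*q≡0⇒q≡0 : ∀ {p q} → p ≢ 0ℚ → p * q ≡ 0ℚ → q ≡ 0ℚ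
p*q≡0⇒q≡0 {p} {q} p≢0 pq≡0 = begin
  q                ≡⟨ sym (*-identityˡ q) ⟩
  1ℚ * q           ≡⟨ cong (_* q) (sym (*-inverseˡ p)) ⟩
  (1/ p * p) * q   ≡⟨ *-assoc (1/ p) p q ⟩
  1/ p * (p * q)   ≡⟨ cong (1/ p *_) pq≡0 ⟩
  1/ p * 0ℚ        ≡⟨ *-zeroʳ (1/ p) ⟩
  0ℚ               ∎
  where
  open ≡-Reasoning
  instance
    p-nonZero : ℚ.NonZero p
    p-nonZero = ℚ.≢-nonZero p≢0

Any⇒↭∷ : ∀ {A : Set} {P : A → Set} {xs} → Any P xs → ∃₂ λ x ys → P x × xs ↭ x ∷ ys
Any⇒↭∷ any with x , x∈xs , px ← find any with ys , zs , refl ← ∈-∃++ x∈xs =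
  x , ys ++ zs , px , shift x ys zs

lookup-injective : ∀ {A : Set} {xs : List A} → Unique xs → ∀ i j → lookup xs i ≡ lookup xs j → i ≡ j
lookup-injective (_ ∷ _)       zero    zero    _ = refl
lookup-injective (x∉xs ∷ _)    zero    (suc j) e = ⊥-elim (All.lookup x∉xs (∈-lookup j) e)
lookup-injective (x∉xs ∷ _)    (suc i) zero    e = ⊥-elim (All.lookup x∉xs (∈-lookup i) (sym e))
lookup-injective (_ ∷ unique)  (suc i) (suc j) e = cong suc (lookup-injective unique i j e)

_·_ : ∀ {k} → Vector ℚ k → Vector ℚ k → ℚ
_·_ {k} μ r = sumℚ k (λ i → μ i * r i)

·-linearʳ : ∀ {k} (ν u v : Vector ℚ k) x y → ν · (λ i → x * u i + y * v i) ≡ x * (ν · u) + y * (ν · v)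
·-linearʳ {k} ν u v x y = begin
  sumℚ k (λ i → ν i * (x * u i + y * v i))
    ≡⟨ sumℚ-cong k (λ i → distribute (ν i) (u i) (v i) x y) ⟩
  sumℚ k (λ i → x * (ν i * u i) + y * (ν i * v i))
    ≡⟨ sumℚ-+ k _ _ ⟩
  sumℚ k (λ i → x * (ν i * u i)) + sumℚ k (λ i → y * (ν i * v i))
    ≡⟨ cong₂ _+_ (sumℚ-*ˡ k x _) (sumℚ-*ˡ k y _) ⟩
  x * (ν · u) + y * (ν · v) ∎
  where
  open ≡-Reasoning
  open +-*-Solver
  distribute : ∀ n u v x y → n * (x * u + y * v) ≡ x * (n * u) + y * (n * v)
  distribute = solve 5 (λ n u v x y → n :* (x :* u :+ y :* v) := x :* (n :* u) :+ y :* (n :* v)) refl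

NontrivialSolution : ∀ {k} → List (Vector ℚ k) → Set
NontrivialSolution {k} rows = Σ (Vector ℚ k) λ μ → All (λ r → μ · r ≡ 0ℚ) rows × ¬ (∀ i → μ i ≡ 0ℚ)

eliminate : ∀ {k} → Vector ℚ (suc k) → Vector ℚ (suc k) → Vector ℚ k
eliminate r s i = r zero * s (suc i) + (- s zero) * r (suc i)

backSubstitute : ∀ {k} → Vector ℚ (suc k) → Vector ℚ k → Vector ℚ (suc k)
backSubstitute r ν = (- (ν · Vector.tail r)) Vector.∷ (λ i → r zero * ν i)

backSubstitute-· : ∀ {k} (r s : Vector ℚ (suc k)) ν → backSubstitute r ν · s ≡ ν · eliminate r s
backSubstitute-· {k} r s ν = begin
  (- (ν · r′)) * s zero + sumℚ k (λ i → r zero * ν i * s′ i)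
    ≡⟨ cong ((- (ν · r′)) * s zero +_) (trans (sumℚ-cong k (λ i → *-assoc (r zero) (ν i) (s′ i))) (sumℚ-*ˡ k (r zero) _)) ⟩
  (- (ν · r′)) * s zero + r zero * (ν · s′)
    ≡⟨ reorder (ν · r′) (s zero) (r zero) (ν · s′) ⟩
  r zero * (ν · s′) + (- s zero) * (ν · r′)
    ≡⟨ sym (·-linearʳ ν s′ r′ (r zero) (- s zero)) ⟩
  ν · eliminate r s ∎
  where
  open ≡-Reasoning
  open +-*-Solver
  r′ = Vector.tail r
  s′ = Vector.tail s
  reorder : ∀ a b c d → (- a) * b + c * d ≡ c * d + (- b) * a
  reorder = solve 4 (λ a b c d → (:- a) :* b :+ c :* d := c :* d :+ (:- b) :* a) refl

backSubstitute-solution : ∀ {k} {r : Vector ℚ (suc k)} {rest} → r zero ≢ 0ℚ →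
  NontrivialSolution (map (eliminate r) rest) → NontrivialSolution (r ∷ rest)
backSubstitute-solution {k} {r} {rest} r₀≢0 (ν , ν⊥ , ν≢0) =
  backSubstitute r ν , μ⊥r ∷ All.map (λ {s} ν⊥s → trans (backSubstitute-· r s ν) ν⊥s) (map⁻ ν⊥) ,
  λ μ≡0 → ν≢0 (λ i → p*q≡0⇒q≡0 r₀≢0 (μ≡0 (suc i)))
  where
  open +-*-Solver
  cancels : ∀ n a b → n * (a * b + (- a) * b) ≡ 0ℚ
  cancels = solve 3 (λ n a b → n :* (a :* b :+ (:- a) :* b) := con 0ℚ) refl
  μ⊥r : backSubstitute r ν · r ≡ 0ℚ
  μ⊥r = trans (backSubstitute-· r r ν) (sumℚ-zero k (λ i → cancels (ν i) (r zero) (r (suc i))))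

underdetermined-solvable : ∀ k (rows : List (Vector ℚ (suc k))) → length rows ≤ k → NontrivialSolution rows
underdetermined-solvable k rows len with all? (λ r → r zero ≟ℚ 0ℚ) rows
... | yes firstZero = 1ℚ Vector.∷ (λ _ → 0ℚ) , All.map (λ {r} → e₀⊥ {r}) firstZero , λ μ≡0 → 1≢0 (μ≡0 zero)
  where
  e₀⊥ : ∀ {r : Vector ℚ (suc k)} → r zero ≡ 0ℚ → (1ℚ Vector.∷ (λ _ → 0ℚ)) · r ≡ 0ℚ
  e₀⊥ {r} r₀≡0 = cong₂ _+_ (trans (*-identityˡ (r zero)) r₀≡0) (sumℚ-zero k (λ i → *-zeroˡ (r (suc i))))
underdetermined-solvable zero [] z≤n | no ¬firstZero = ⊥-elim (¬firstZero [])
underdetermined-solvable (suc k) rows len | no ¬firstZero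
  with r , rest , r₀≢0 , rows↭ ← Any⇒↭∷ (¬All⇒Any¬ (λ r → r zero ≟ℚ 0ℚ) rows ¬firstZero) =
  let ν , ν⊥ , ν≢0 = underdetermined-solvable k (map (eliminate r) rest) len′
      μ , μ⊥ , μ≢0 = backSubstitute-solution r₀≢0 (ν , ν⊥ , ν≢0)
  in μ , All-resp-↭ (↭-sym rows↭) μ⊥ , μ≢0
  where
  len′ : length (map (eliminate r) rest) ≤ k
  len′ = subst (_≤ k) (sym (length-map _ rest)) (s≤s⁻¹ (subst (_≤ suc k) (↭-length rows↭) len))

unitriangular⇒independent : ∀ {m} (M : Fin m → Fin m → ℚ) (rank : Fin m → ℕ) →
  (∀ j → M j j ≡ 1ℚ) → (∀ i j → i ≢ j → rank j ≤ rank i → M i j ≡ 0ℚ) →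
  (l : Fin m → ℚ) → (∀ j → sumℚ m (λ i → l i * M i j) ≡ 0ℚ) → ∀ j → l j ≡ 0ℚ
unitriangular⇒independent {m} M rank diagonal upper l lM≡0 j = below (suc (rank j)) j ≤-refl
  where
  below : ∀ r j → rank j < r → l j ≡ 0ℚ
  below (suc r) j rank<r = begin
    l j                        ≡⟨ sym (*-identityʳ (l j)) ⟩
    l j * 1ℚ                   ≡⟨ cong (l j *_) (sym (diagonal j)) ⟩
    l j * M j j                ≡⟨ sym (sumℚ-single m j offDiagonal) ⟩
    sumℚ m (λ i → l i * M i j) ≡⟨ lM≡0 j ⟩
    0ℚ                         ∎
    where
    open ≡-Reasoning
    offDiagonal : ∀ i → i ≢ j → l i * M i j ≡ 0ℚ
    offDiagonal i i≢j with rank i <? rank j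
    ... | yes i<j = trans (cong (_* M i j) (below r i (<-≤-trans i<j (s≤s⁻¹ rank<r)))) (*-zeroˡ (M i j))
    ... | no  i≮j = trans (cong (l i *_) (upper i j i≢j (≮⇒≥ i≮j))) (*-zeroʳ (l i))

-- sumFamily sums with a loop local to its where-block; abstracting over allSubsets n lets
-- unification name that loop, which can then be reasoned about by induction on lists.
sumFamily-loop : ∀ {n} (a : Fin n) (x : Point n) →
  Σ (List (Subset n) → ℚ) λ loop → loop (allSubsets n) ≡ sumFamily a x
sumFamily-loop {n} a x = loop , unfold
  where
  loop : List (Subset n) → ℚ
  loop = _
  unfold : loop (allSubsets n) ≡ sumFamily a x
  unfold with allSubsets n
  ... | _ = refl

familySum : ∀ {n} → Fin n → Point n → List (Subset n) → ℚ
familySum a x = proj₁ (sumFamily-loop a x)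

familySum-linear : ∀ {n} (a : Fin n) k (l : Fin k → ℚ) (p : Fin k → Point n) Bs →
  familySum a (λ b B → sumℚ k (λ i → l i * p i b B)) Bs ≡ sumℚ k (λ i → l i * familySum a (p i) Bs)
familySum-linear a k l p [] = sym (sumℚ-zero k (λ i → *-zeroʳ (l i)))
familySum-linear a k l p (B ∷ Bs) with a ∈? B | nonempty? B
... | yes _ | _     = familySum-linear a k l p Bs
... | no _  | no _  = familySum-linear a k l p Bs
... | no _  | yes _ = begin
  sumℚ k (λ i → l i * p i a B) + familySum a _ Bs
    ≡⟨ cong (sumℚ k (λ i → l i * p i a B) +_) (familySum-linear a k l p Bs) ⟩
  sumℚ k (λ i → l i * p i a B) + sumℚ k (λ i → l i * familySum a (p i) Bs)
    ≡⟨ sym (sumℚ-+ k _ _) ⟩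
  sumℚ k (λ i → l i * p i a B + l i * familySum a (p i) Bs)
    ≡⟨ sumℚ-cong k (λ i → sym (*-distribˡ-+ (l i) _ _)) ⟩
  sumℚ k (λ i → l i * (p i a B + familySum a (p i) Bs)) ∎
  where open ≡-Reasoning

familySum-vanishing : ∀ {n} (a : Fin n) (x : Point n) {Bs} →
  All (λ B → InΥ a B → x a B ≡ 0ℚ) Bs → familySum a x Bs ≡ 0ℚ
familySum-vanishing a x [] = refl
familySum-vanishing a x {B ∷ Bs} (x≡0 ∷ xs≡0) with a ∈? B | nonempty? B
... | yes _   | _      = familySum-vanishing a x xs≡0
... | no _    | no _   = familySum-vanishing a x xs≡0
... | no a∉B  | yes ne = cong₂ _+_ (x≡0 (a∉B , ne)) (familySum-vanishing a x xs≡0)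

familySum-single : ∀ {n} (a : Fin n) (x : Point n) {P Bs} → Unique Bs → P ∈ₗ Bs → InΥ a P →
  (∀ B → B ≢ P → x a B ≡ 0ℚ) → familySum a x Bs ≡ x a P
familySum-single a x {P} {B ∷ Bs} (B∉Bs ∷ unique) P∈ (a∉P , P≢∅) x≡0 with a ∈? B | nonempty? B | P∈
... | yes a∈B | _      | here refl = contradiction a∈B a∉P
... | no _    | no B≡∅ | here refl = contradiction P≢∅ B≡∅
... | no _    | yes _  | here refl =
  trans (cong (x a B +_) (familySum-vanishing a x (All.map (λ B≢B′ _ → x≡0 _ (≢-sym B≢B′)) B∉Bs)))
        (+-identityʳ (x a B))
... | yes _   | _      | there P∈Bs = familySum-single a x unique P∈Bs (a∉P , P≢∅) x≡0
... | no _    | no _   | there P∈Bs = familySum-single a x unique P∈Bs (a∉P , P≢∅) x≡0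
... | no _    | yes _  | there P∈Bs =
  trans (cong₂ _+_ (x≡0 B (All.lookup B∉Bs P∈Bs)) (familySum-single a x unique P∈Bs (a∉P , P≢∅) x≡0))
        (+-identityˡ (x a P))

allSubsets-complete : ∀ n (B : Subset n) → B ∈ₗ allSubsets n
allSubsets-complete zero    []            = here refl
allSubsets-complete (suc n) (outside ∷ B) = ∈-++⁺ˡ (∈-map⁺ (outside ∷_) (allSubsets-complete n B))
allSubsets-complete (suc n) (inside ∷ B)  =
  ∈-++⁺ʳ (map (outside ∷_) (allSubsets n)) (∈-map⁺ (inside ∷_) (allSubsets-complete n B))

allSubsets-unique : ∀ n → Unique (allSubsets n)
allSubsets-unique zero    = [] ∷ []
allSubsets-unique (suc n) =
  Unique.++⁺ (Unique.map⁺ ∷-injectiveʳ (allSubsets-unique n)) (Unique.map⁺ ∷-injectiveʳ (allSubsets-unique n)) disjoint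
  where
  disjoint : ∀ {B} → B ∈ₗ map (outside ∷_) (allSubsets n) × B ∈ₗ map (inside ∷_) (allSubsets n) → ⊥
  disjoint (B∈outside , B∈inside) with ∈-map⁻ (outside ∷_) B∈outside | ∈-map⁻ (inside ∷_) B∈inside
  ... | _ , _ , refl | _ , _ , ()

η-≡ : ∀ {n} (G : DAG n) {b B} → B ≡ paOf G b → η G b B ≡ 1ℚ
η-≡ G {b} {B} B≡pa with B ≟ₛ paOf G b
... | yes _    = refl
... | no  B≢pa = contradiction B≡pa B≢pa

η-≢ : ∀ {n} (G : DAG n) {b B} → B ≢ paOf G b → η G b B ≡ 0ℚ
η-≢ G {b} {B} B≢pa with B ≟ₛ paOf G b
... | yes B≡pa = contradiction B≡pa B≢pa
... | no  _    = refl

sumFamily-linear : ∀ {n} (a : Fin n) k (l : Fin k → ℚ) (p : Fin k → Point n) →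
  sumFamily a (λ b B → sumℚ k (λ i → l i * p i b B)) ≡ sumℚ k (λ i → l i * sumFamily a (p i))
sumFamily-linear {n} a k l p = familySum-linear a k l p (allSubsets n)

sumFamily-vanishing : ∀ {n} (a : Fin n) (x : Point n) → (∀ B → InΥ a B → x a B ≡ 0ℚ) → sumFamily a x ≡ 0ℚ
sumFamily-vanishing {n} a x x≡0 = familySum-vanishing a x (All.universal x≡0 (allSubsets n))

sumFamily-η : ∀ {n} (a : Fin n) (G : DAG n) → InΥ a (paOf G a) → sumFamily a (η G) ≡ 1ℚ
sumFamily-η {n} a G inΥ =
  trans (familySum-single a (η G) (allSubsets-unique n) (allSubsets-complete n _) inΥ (λ B → η-≢ G))
        (η-≡ G refl)

sumFamily-η-≤1 : ∀ {n} (a : Fin n) (G : DAG n) → sumFamily a (η G) ℚ.≤ 1ℚ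
sumFamily-η-≤1 a G with ¬? (a ∈? paOf G a) ×-dec nonempty? (paOf G a)
... | yes inΥ = subst (ℚ._≤ 1ℚ) (sym (sumFamily-η a G inΥ)) ≤ℚ-refl
... | no ¬inΥ = subst (ℚ._≤ 1ℚ) (sym (sumFamily-vanishing a (η G) pa∉Υ)) (nonNegative⁻¹ 1ℚ)
  where
  pa∉Υ : ∀ B → InΥ a B → η G a B ≡ 0ℚ
  pa∉Υ B inΥ = η-≢ G (λ B≡pa → ¬inΥ (subst (InΥ a) B≡pa inΥ))

acyclic-by-rank : ∀ {n} {pa : Fin n → Subset n} (rank : Fin n → ℕ) →
  (∀ {i j} → i ∈ pa j → rank i < rank j) → Acyclic pa
acyclic-by-rank {pa = pa} rank increasing i walk = <-irrefl refl (rank-increases walk)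
  where
  rank-increases : ∀ {i j} → Walk pa i j → rank i < rank j
  rank-increases (edge i∈pa)      = increasing i∈pa
  rank-increases (step i∈pa walk) = <-trans (increasing i∈pa) (rank-increases walk)

emptyDAG : ∀ {n} → DAG n
emptyDAG = (λ _ → ∅) , acyclic-by-rank (λ _ → 0) (λ i∈∅ → contradiction i∈∅ ∉⊥)

η-emptyDAG : ∀ {n} (b : Fin n) {B} → Nonempty B → η emptyDAG b B ≡ 0ℚ
η-emptyDAG b (i , i∈B) = η-≢ emptyDAG (λ B≡∅ → ∉⊥ (subst (i ∈_) B≡∅ i∈B))

-- η emptyDAG vanishes on Υ, so applying the linear map sumFamily a (which is 1 at each η (Gs i))
-- to a vanishing affine combination shows that the coefficients of the Gs alone sum to 0.
∷-emptyDAG-independent : ∀ {n k} (a : Fin n) (Gs : Fin k → DAG n) → (∀ i → sumFamily a (η (Gs i)) ≡ 1ℚ) →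
  AffinelyIndependent (η ∘ Gs) → AffinelyIndependent (η ∘ (emptyDAG Vector.∷ Gs))
∷-emptyDAG-independent {n} {k} a Gs onFace independent l Σl≡0 Σlη≡0 = l≡0
  where
  l′ = Vector.tail l
  Σl′η≡0 : ∀ b B → InΥ b B → sumℚ k (λ i → l′ i * η (Gs i) b B) ≡ 0ℚ
  Σl′η≡0 b B inΥ = begin
    Σ′                                ≡⟨ sym (+-identityˡ Σ′) ⟩
    0ℚ + Σ′                           ≡⟨ cong (_+ Σ′) (sym (*-zeroʳ (l zero))) ⟩
    l zero * 0ℚ + Σ′                  ≡⟨ cong (λ t → l zero * t + Σ′) (sym (η-emptyDAG b (proj₂ inΥ))) ⟩
    l zero * η emptyDAG b B + Σ′      ≡⟨ Σlη≡0 b B inΥ ⟩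
    0ℚ                                ∎
    where
    open ≡-Reasoning
    Σ′ = sumℚ k (λ i → l′ i * η (Gs i) b B)
  Σl′≡0 : sumℚ k l′ ≡ 0ℚ
  Σl′≡0 = begin
    sumℚ k l′                                          ≡⟨ sumℚ-cong k (λ i → sym (trans (cong (l′ i *_) (onFace i)) (*-identityʳ (l′ i)))) ⟩
    sumℚ k (λ i → l′ i * sumFamily a (η (Gs i)))       ≡⟨ sym (sumFamily-linear a k l′ (η ∘ Gs)) ⟩
    sumFamily a (λ b B → sumℚ k (λ i → l′ i * η (Gs i) b B)) ≡⟨ sumFamily-vanishing a _ (Σl′η≡0 a) ⟩
    0ℚ                                                 ∎
    where open ≡-Reasoning
  l≡0 : ∀ i → l i ≡ 0ℚ
  l≡0 zero    = trans (sym (+-identityʳ (l zero))) (trans (cong (l zero +_) (sym Σl′≡0)) Σl≡0)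
  l≡0 (suc i) = independent l′ Σl′≡0 Σl′η≡0 i

CoversΥ : ∀ {n} → List (Fin n × Subset n) → Set
CoversΥ L = ∀ {b B} → InΥ b B → (b , B) ∈ₗ L

-- |Υ| + 2 points in ℚ^Υ give |Υ| + 1 homogeneous equations in |Υ| + 2 unknowns.
¬AffinelyIndependent-2+∣Υ∣ : ∀ {n} (L : List (Fin n × Subset n)) → CoversΥ L →
  (p : Fin (suc (suc (length L))) → Point n) → ¬ AffinelyIndependent p
¬AffinelyIndependent-2+∣Υ∣ L covers p independent =
  μ≢0 (independent μ Σμ≡0 (λ b B inΥ → All.lookup (map⁻ (All.tail μ⊥)) (covers inΥ)))
  where
  coordinate : Fin _ × Subset _ → Vector ℚ (suc (suc (length L)))
  coordinate (b , B) i = p i b B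
  solution = underdetermined-solvable (suc (length L)) ((λ _ → 1ℚ) ∷ map coordinate L)
                                      (s≤s (≤-reflexive (length-map coordinate L)))
  μ  = proj₁ solution
  μ⊥ = proj₁ (proj₂ solution)
  μ≢0 = proj₂ (proj₂ solution)
  Σμ≡0 : sumℚ _ μ ≡ 0ℚ
  Σμ≡0 = trans (sumℚ-cong _ (λ i → sym (*-identityʳ (μ i)))) (All.head μ⊥)

facet-of-independent-face : ∀ {n} (a : Fin n) (L : List (Fin n × Subset n)) → CoversΥ L → ∀ {u} → u ∈ₗ L →
  (Hs : Fin (length L) → DAG n) → (∀ i → sumFamily a (η (Hs i)) ≡ 1ℚ) → AffinelyIndependent (η ∘ Hs) →
  DefinesFacet (sumFamily a) 1ℚ
facet-of-independent-face a L@(_ ∷ us) covers _ Hs onFace independent =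
  sumFamily-η-≤1 a , length us , faceDimension , polytopeDimension
  where
  faceDimension : ConvDim (λ G → sumFamily a (η G) ≡ 1ℚ) (length us)
  faceDimension = (Hs , onFace , independent) , λ Gs onFace′ independent′ →
    ¬AffinelyIndependent-2+∣Υ∣ L covers (η ∘ (emptyDAG Vector.∷ Gs)) (∷-emptyDAG-independent a Gs onFace′ independent′)
  polytopeDimension : ConvDim AllDAGs (suc (length us))
  polytopeDimension = (emptyDAG Vector.∷ Hs , _ , ∷-emptyDAG-independent a Hs onFace independent) ,
    λ Gs _ → ¬AffinelyIndependent-2+∣Υ∣ L covers (η ∘ Gs)

InΥ? : ∀ {n} (p : Fin n × Subset n) → Dec (uncurry InΥ p)
InΥ? (b , B) = ¬? (b ∈? B) ×-dec nonempty? B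

Υ : ∀ n → List (Fin n × Subset n)
Υ n = filter InΥ? (cartesianProduct (allFin n) (allSubsets n))

Υ-unique : ∀ n → Unique (Υ n)
Υ-unique n = Unique.filter⁺ InΥ? (Unique.cartesianProduct⁺ (Unique.allFin⁺ n) (allSubsets-unique n))

Υ-sound : ∀ n → All (uncurry InΥ) (Υ n)
Υ-sound n = all-filter InΥ? (cartesianProduct (allFin n) (allSubsets n))

Υ-complete : ∀ n → CoversΥ (Υ n)
Υ-complete n {b} {B} inΥ = ∈-filter⁺ InΥ? (∈-cartesianProduct⁺ (∈-allFin b) (allSubsets-complete n B)) inΥ

InΥ-⁅⁆ : ∀ {n} {b x : Fin n} → x ≢ b → InΥ b ⁅ x ⁆
InΥ-⁅⁆ {x = x} x≢b = (λ b∈⁅x⁆ → x≢b (sym (x∈⁅y⁆⇒x≡y x b∈⁅x⁆))) , x , x∈⁅x⁆ x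

module TwoFamilies {n} (a b : Fin n) (C : Subset n) (x : Fin n) where

  parents : Fin n → Subset n
  parents j with j ≟ b | j ≟ a
  ... | yes _ | _     = C
  ... | no _  | yes _ = ⁅ x ⁆
  ... | no _  | no _  = ∅

  rank : Fin n → ℕ
  rank j with j ≟ b | j ≟ a
  ... | yes _ | _     = 2
  ... | no _  | yes _ = 1
  ... | no _  | no _  = 0

  parents-b : parents b ≡ C
  parents-b with b ≟ b
  ... | yes _   = refl
  ... | no b≢b  = contradiction refl b≢b

  parents-a : b ≢ a → parents a ≡ ⁅ x ⁆
  parents-a b≢a with a ≟ b | a ≟ a
  ... | yes a≡b | _       = contradiction (sym a≡b) b≢a
  ... | no _    | yes _   = refl
  ... | no _    | no a≢a  = contradiction refl a≢a

  parents-≢ : ∀ {b′ C′} → Nonempty C′ → b′ ≢ a ⊎ b′ ≡ b → (b′ , C′) ≢ (b , C) → C′ ≢ parents b′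
  parents-≢ {b′} (c , c∈C′) b′≢a⊎b′≡b p′≢p C′≡pa with b′ ≟ b | b′ ≟ a
  ... | yes refl | _        = p′≢p (cong (b ,_) C′≡pa)
  ... | no b′≢b  | yes b′≡a = [ (λ b′≢a → b′≢a b′≡a) , b′≢b ]′ b′≢a⊎b′≡b
  ... | no _     | no _     = ∉⊥ (subst (c ∈_) C′≡pa c∈C′)

  rank≤1 : ∀ {i} → i ≢ b → rank i ≤ 1
  rank≤1 {i} i≢b with i ≟ b | i ≟ a
  ... | yes i≡b | _     = contradiction i≡b i≢b
  ... | no _    | yes _ = s≤s z≤n
  ... | no _    | no _  = z≤n

  rank≡0 : ∀ {i} → i ≢ b → i ≢ a → rank i ≡ 0
  rank≡0 {i} i≢b i≢a with i ≟ b | i ≟ a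
  ... | yes i≡b | _       = contradiction i≡b i≢b
  ... | no _    | yes i≡a = contradiction i≡a i≢a
  ... | no _    | no _    = refl

  acyclic : b ∉ C → x ≢ a → x ≢ b → Acyclic parents
  acyclic b∉C x≢a x≢b = acyclic-by-rank rank increasing
    where
    increasing : ∀ {i j} → i ∈ parents j → rank i < rank j
    increasing {i} {j} i∈pa with j ≟ b | j ≟ a
    ... | yes _ | _     = s≤s (rank≤1 (λ i≡b → b∉C (subst (_∈ C) i≡b i∈pa)))
    ... | no _  | yes _ = subst (_< 1) (sym (trans (cong rank (x∈⁅y⁆⇒x≡y x i∈pa)) (rank≡0 x≢b x≢a))) (s≤s z≤n)
    ... | no _  | no _  = contradiction i∈pa ∉⊥

module FaceVertices {n} (a : Fin n) (third : (b : Fin n) → ∃ λ x → x ≢ a × x ≢ b) where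

  vertex : (p : Fin n × Subset n) → uncurry InΥ p → DAG n
  vertex (b , C) (b∉C , _) = parents , acyclic b∉C (proj₁ (proj₂ (third b))) (proj₂ (proj₂ (third b)))
    where open TwoFamilies a b C (proj₁ (third b))

  vertex-onFace : ∀ p inΥ → sumFamily a (η (vertex p inΥ)) ≡ 1ℚ
  vertex-onFace (b , C) inΥ = sumFamily-η a (vertex (b , C) inΥ) familyOfA
    where
    open TwoFamilies a b C (proj₁ (third b))
    familyOfA : InΥ a (parents a)
    familyOfA with b ≟ a
    ... | yes refl = subst (InΥ b) (sym parents-b) inΥ
    ... | no b≢a   = subst (InΥ a) (sym (parents-a b≢a)) (InΥ-⁅⁆ (proj₁ (proj₂ (third b))))

  η-vertex-self : ∀ p inΥ → η (vertex p inΥ) (proj₁ p) (proj₂ p) ≡ 1ℚ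
  η-vertex-self (b , C) inΥ = η-≡ (vertex (b , C) inΥ) (sym parents-b)
    where open TwoFamilies a b C (proj₁ (third b))

  η-vertex-other : ∀ p inΥ {b′ C′} → Nonempty C′ → b′ ≢ a ⊎ b′ ≡ proj₁ p → (b′ , C′) ≢ p →
    η (vertex p inΥ) b′ C′ ≡ 0ℚ
  η-vertex-other (b , C) inΥ C′≢∅ b′≢a⊎b′≡b p′≢p = η-≢ (vertex (b , C) inΥ) (parents-≢ C′≢∅ b′≢a⊎b′≡b p′≢p)
    where open TwoFamilies a b C (proj₁ (third b))

  level : Fin n → ℕ
  level b with b ≟ a
  ... | yes _ = 1
  ... | no _  = 0

  level-≤ : ∀ {b b′} → level b′ ≤ level b → b′ ≢ a ⊎ b′ ≡ b
  level-≤ {b} {b′} b′≤b with b′ ≟ a | b ≟ a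
  ... | no b′≢a  | _        = inj₁ b′≢a
  ... | yes refl | yes refl = inj₂ refl
  ... | yes _    | no _     = contradiction b′≤b λ ()

  vertexAt : (L : List (Fin n × Subset n)) → All (uncurry InΥ) L → Fin (length L) → DAG n
  vertexAt L inΥ i = vertex (lookup L i) (All.lookup inΥ (∈-lookup i))

  vertexAt-onFace : ∀ L inΥ i → sumFamily a (η (vertexAt L inΥ i)) ≡ 1ℚ
  vertexAt-onFace L inΥ i = vertex-onFace (lookup L i) (All.lookup inΥ (∈-lookup i))

  -- Off its own family, the vertex of (b|C) is nonzero only at (a|{x}) when b ≢ a, so ranking the
  -- families of a above all others makes the matrix unitriangular.
  vertexAt-independent : ∀ {L} → Unique L → (inΥ : All (uncurry InΥ) L) → AffinelyIndependent (η ∘ vertexAt L inΥ)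
  vertexAt-independent {L} unique inΥ l _ Σlη≡0 =
    unitriangular⇒independent M (level ∘ family) diagonal upper l (λ j → Σlη≡0 (family j) (parents j) (inΥ′ j))
    where
    family  = proj₁ ∘ lookup L
    parents = proj₂ ∘ lookup L
    inΥ′ : ∀ j → InΥ (family j) (parents j)
    inΥ′ j = All.lookup inΥ (∈-lookup j)
    M : Fin (length L) → Fin (length L) → ℚ
    M i j = η (vertexAt L inΥ i) (family j) (parents j)
    diagonal : ∀ j → M j j ≡ 1ℚ
    diagonal j = η-vertex-self (lookup L j) (inΥ′ j)
    upper : ∀ i j → i ≢ j → level (family j) ≤ level (family i) → M i j ≡ 0ℚ
    upper i j i≢j j≤i = η-vertex-other (lookup L i) (inΥ′ i) (proj₂ (inΥ′ j)) (level-≤ j≤i)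
                                       (λ j≡i → i≢j (lookup-injective unique i j (sym j≡i)))

third : ∀ {n} (a b : Fin (suc (suc (suc n)))) → ∃ λ x → x ≢ a × x ≢ b
third 0F           0F           = 1F , (λ ()) , (λ ())
third 0F           1F           = 2F , (λ ()) , (λ ())
third 0F           (suc (suc _)) = 1F , (λ ()) , (λ ())
third 1F           0F           = 2F , (λ ()) , (λ ())
third (suc (suc _)) 0F           = 1F , (λ ()) , (λ ())
third (suc _)      (suc _)      = 0F , (λ ()) , (λ ())

lemma3 : (n : ℕ) → n ≥ 3 → (a : Fin n) → DefinesFacet (sumFamily a) 1ℚ
lemma3 0                   ()                  _
lemma3 1                   (s≤s ())            _
lemma3 2                   (s≤s (s≤s ()))      _
lemma3 (suc (suc (suc n))) _ a =
  facet-of-independent-face a (Υ _) (Υ-complete _) (Υ-complete _ (InΥ-⁅⁆ {b = 1F} {x = 0F} λ ()))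
    (vertexAt (Υ _) (Υ-sound _)) (vertexAt-onFace (Υ _) (Υ-sound _)) (vertexAt-independent (Υ-unique _) (Υ-sound _))
  where open FaceVertices a (third a)
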